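{- Let $S=\{0,\ldots,p-1\}$, $m=L+1+R\ge 1$ with $L,R\ge 0$, $f:S^m\to S$, and let $\tau:S^{\mathbb Z}\to S^{\mathbb Z}$ be the global map $\tau(c)_i=f(c_{i-L},\ldots,c_{i+R})$. If there exist periodic local configurations $\alpha,\beta$ (finite words over $S$), then $\tau$ is not injective.
   Context: For a finite word $x=x_1\cdots x_n$ with $n\ge m$, its successor under $f$ is the word $f(x)=y_1\cdots y_{n-m+1}$ with $y_i=f(x_i\cdots x_{i+m-1})$. For $k\le n$, $\mathrm{left}_k(x)=x_1\cdots x_k$ and $\mathrm{right}_k(x)=x_{n-k+1}\cdots x_n$. Two finite words $\alpha,\beta$ are periodic local configurations if: each has length at least $m$; $\alpha\ne\beta$; $\mathrm{left}_{m-1}(\alpha)=\mathrm{right}_{m-1}(\alpha)$; $\mathrm{left}_{m-1}(\beta)=\mathrm{right}_{m-1}(\beta)$; and $\alpha,\beta$ have the same successor under $f$ (so in particular they have the same length). -}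

module Defs where

open import Data.Nat using (ℕ; zero; suc; _+_; _≤_)
open import Data.Fin using (Fin; toℕ)
open import Data.Integer as ℤ using (ℤ)
open import Data.List using (List; []; _∷_; length; take; drop; reverse)
open import Data.Vec using (Vec; tabulate)
open import Data.Product using (_×_)
open import Relation.Binary.PropositionalEquality using (_≡_; _≢_)
open import Relation.Nullary using (¬_)

Alphabet : ℕ → Set
Alphabet p = Fin p

Config : ℕ → Set
Config p = ℤ → Fin p

globalMap : ∀ {p} (L R : ℕ) → (Vec (Fin p) (L + 1 + R) → Fin p) → Config p → Config p
globalMap L R f c i =
  f (tabulate (λ j → c ((i ℤ.- ℤ.+ L) ℤ.+ ℤ.+ (toℕ j))))

_≈c_ : ∀ {p} → Config p → Config p → Set
c ≈c d = ∀ i → c i ≡ d i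

InjectiveCA : ∀ {p} → (Config p → Config p) → Set
InjectiveCA τ = ∀ c d → τ c ≈c τ d → c ≈c d

open import Data.Maybe using (Maybe; just; nothing)

window : ∀ {A : Set} (m : ℕ) → List A → Maybe (Vec A m)
window zero xs = just Data.Vec.[]
window (suc m) [] = nothing
window (suc m) (x ∷ xs) with window m xs
... | just v = just (x Data.Vec.∷ v)
... | nothing = nothing

successor : ∀ {A : Set} (m : ℕ) → (Vec A m → A) → List A → List A
successor m f [] = []
successor m f (x ∷ xs) with window m (x ∷ xs)
... | just v = f v ∷ successor m f xs
... | nothing = []

left : ∀ {A : Set} → ℕ → List A → List A
left k x = take k x

right : ∀ {A : Set} → ℕ → List A → List A
right k x = reverse (take k (reverse x))

PeriodicLocalConfigs : ∀ {A : Set} (m : ℕ) → (Vec A m → A) → List A → List A → Set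
PeriodicLocalConfigs m f α β =
  (m ≤ length α) × (m ≤ length β) × (α ≢ β)
  × (left (m Data.Nat.∸ 1) α ≡ right (m Data.Nat.∸ 1) α)
  × (left (m Data.Nat.∸ 1) β ≡ right (m Data.Nat.∸ 1) β)
  × (successor m f α ≡ successor m f β)

-- Let k = m − 1. Because left_k(α) = right_k(α), the word α of length q + k is
-- a window of the q-periodic configuration c_α(x) = α_(x mod q), so every
-- length-m window of c_α is a length-m window of α and τ(c_α) is the
-- q-periodic extension of the successor f(α). The same holds for β with the
-- same q, since f(α) = f(β) forces |α| = |β|. Hence τ(c_α) = τ(c_β), while
-- c_α ≠ c_β because α ≠ β.
module Submission where

open import Defs
open import Data.Fin using (Fin; toℕ)
open import Data.Fin.Properties using (toℕ≤pred[n])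
open import Data.Integer as ℤ using (ℤ; +_; -[1+_])
import Data.Integer.Properties as ℤ
open import Data.List using (List; []; _∷_; length; take; drop; reverse; _++_)
open import Data.List.Properties using (take++drop≡id; reverse-++; reverse-involutive; length-reverse; length-drop)
open import Data.Maybe using (just; nothing)
open import Data.Nat using (ℕ; zero; suc; _+_; _∸_; _*_; _≤_; _<_; z≤n; s≤s; _%_; _/_)
open import Data.Nat.DivMod using (m%n<n; m%n%n≡m%n; %-distribˡ-+; n%n≡0; m<n⇒m%n≡m; [m+n]%n≡m%n; m≡m%n+[m/n]*n)
open import Data.Nat.Properties
open import Algebra.Properties.CommutativeSemigroup +-commutativeSemigroup using (x∙yz≈y∙xz)
open import Data.Product using (_×_; _,_; ∃₂)
open import Data.Vec using (Vec; tabulate)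
open import Data.Vec.Properties using (tabulate-cong)
open import Relation.Binary.PropositionalEquality
open import Relation.Nullary using (¬_; yes; no)

at : ∀ {A : Set} → A → List A → ℕ → A
at d []       _       = d
at d (x ∷ xs) zero    = x
at d (x ∷ xs) (suc i) = at d xs i

module _ {A : Set} (d : A) where

  at-take : ∀ k (xs : List A) {j} → j < k → at d (take k xs) j ≡ at d xs j
  at-take (suc k) []       _                  = refl
  at-take (suc k) (x ∷ xs) {zero}  _         = refl
  at-take (suc k) (x ∷ xs) {suc j} (s≤s j<k) = at-take k xs j<k

  at-drop : ∀ t (xs : List A) j → at d (drop t xs) j ≡ at d xs (t + j)
  at-drop zero    xs       j = refl
  at-drop (suc t) []       j = refl
  at-drop (suc t) (x ∷ xs) j = at-drop t xs j

  at-ext : ∀ (xs ys : List A) → length xs ≡ length ys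
         → (∀ {t} → t < length xs → at d xs t ≡ at d ys t) → xs ≡ ys
  at-ext []       []       _   _  = refl
  at-ext (x ∷ xs) (y ∷ ys) len≡ eq =
    cong₂ _∷_ (eq (s≤s z≤n)) (at-ext xs ys (suc-injective len≡) (λ t< → eq (s≤s t<)))

  window≡just : ∀ m (xs : List A) → m ≤ length xs
              → window m xs ≡ just (tabulate (λ j → at d xs (toℕ j)))
  window≡just zero    xs       _         = refl
  window≡just (suc m) (x ∷ xs) (s≤s m≤n) rewrite window≡just m xs m≤n = refl

  window≡nothing : ∀ m (xs : List A) → length xs < m → window m xs ≡ nothing
  window≡nothing (suc m) []       _         = refl
  window≡nothing (suc m) (x ∷ xs) (s≤s n<m) rewrite window≡nothing m xs n<m = refl

  length-successor : ∀ k (f : Vec A (suc k) → A) (xs : List A)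
                   → length (successor (suc k) f xs) ≡ length xs ∸ k
  length-successor k f []       = sym (0∸n≡0 k)
  length-successor k f (x ∷ xs) with k ≤? length xs
  ... | yes k≤n rewrite window≡just (suc k) (x ∷ xs) (s≤s k≤n) =
    trans (cong suc (length-successor k f xs)) (sym (+-∸-assoc 1 k≤n))
  ... | no k≰n rewrite window≡nothing (suc k) (x ∷ xs) (s≤s (≰⇒> k≰n)) =
    sym (m≤n⇒m∸n≡0 (≰⇒> k≰n))

  at-successor : ∀ k (f : Vec A (suc k) → A) (xs : List A) r → r + suc k ≤ length xs
               → at d (successor (suc k) f xs) r ≡ f (tabulate (λ j → at d xs (r + toℕ j)))
  at-successor k f [] r le with () ← ≤-trans (m≤n+m (suc k) r) le
  at-successor k f (x ∷ xs) zero le rewrite window≡just (suc k) (x ∷ xs) le = refl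
  at-successor k f (x ∷ xs) (suc r) (s≤s le)
    rewrite window≡just (suc k) (x ∷ xs) (≤-trans (m≤n+m (suc k) r) (≤-trans (n≤1+n _) (s≤s le))) =
    at-successor k f xs r le

take-length-++ : ∀ {A : Set} (xs ys : List A) → take (length xs) (xs ++ ys) ≡ xs
take-length-++ []       ys = refl
take-length-++ (x ∷ xs) ys = cong (x ∷_) (take-length-++ xs ys)

right≡drop : ∀ {A : Set} k (xs : List A) → k ≤ length xs → right k xs ≡ drop (length xs ∸ k) xs
right≡drop {A} k xs k≤n = begin
  reverse (take k (reverse xs))                        ≡⟨ cong (λ u → reverse (take k (reverse u))) (take++drop≡id t xs) ⟨
  reverse (take k (reverse (ys ++ zs)))                ≡⟨ cong (λ u → reverse (take k u)) (reverse-++ ys zs) ⟩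
  reverse (take k (reverse zs ++ reverse ys))          ≡⟨ cong (λ u → reverse (take u (reverse zs ++ reverse ys))) |zs|≡k ⟨
  reverse (take (length (reverse zs)) (reverse zs ++ reverse ys)) ≡⟨ cong reverse (take-length-++ (reverse zs) (reverse ys)) ⟩
  reverse (reverse zs)                                 ≡⟨ reverse-involutive zs ⟩
  zs                                                   ∎
  where
  open ≡-Reasoning
  t : ℕ
  t = length xs ∸ k
  ys zs : List A
  ys = take t xs
  zs = drop t xs
  |zs|≡k : length (reverse zs) ≡ k
  |zs|≡k = trans (length-reverse zs) (trans (length-drop t xs) (m∸[m∸n]≡n k≤n))

module Residue (q-1 : ℕ) where

  q : ℕ
  q = suc q-1

  -- q-1 ≡ −1 (mod q), so q-1 * (n + 1) is a residue of −(n + 1).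
  residue : ℤ → ℕ
  residue (+ n)    = n % q
  residue -[1+ n ] = (q-1 * suc n) % q

  residue<q : ∀ x → residue x < q
  residue<q (+ n)    = m%n<n n q
  residue<q -[1+ n ] = m%n<n (q-1 * suc n) q

  [m%q+n]%q≡[m+n]%q : ∀ m n → (m % q + n) % q ≡ (m + n) % q
  [m%q+n]%q≡[m+n]%q m n = begin
    (m % q + n) % q           ≡⟨ %-distribˡ-+ (m % q) n q ⟩
    (m % q % q + n % q) % q   ≡⟨ cong (λ u → (u + n % q) % q) (m%n%n≡m%n m q) ⟩
    (m % q + n % q) % q       ≡⟨ %-distribˡ-+ m n q ⟨
    (m + n) % q               ∎
    where open ≡-Reasoning

  [1+m%q]%q≡[1+m]%q : ∀ m → suc (m % q) % q ≡ suc m % q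
  [1+m%q]%q≡[1+m]%q m = begin
    suc (m % q) % q           ≡⟨ cong (_% q) (+-comm 1 (m % q)) ⟩
    (m % q + 1) % q           ≡⟨ [m%q+n]%q≡[m+n]%q m 1 ⟩
    (m + 1) % q               ≡⟨ cong (_% q) (+-comm m 1) ⟩
    suc m % q                 ∎
    where open ≡-Reasoning

  residue-suc : ∀ x → residue (x ℤ.+ + 1) ≡ suc (residue x) % q
  residue-suc (+ n)        = trans (cong (_% q) (+-comm n 1)) (sym ([1+m%q]%q≡[1+m]%q n))
  residue-suc -[1+ zero ]  = begin
    0                                 ≡⟨ n%n≡0 q ⟨
    q % q                             ≡⟨ cong (λ u → suc u % q) (m<n⇒m%n≡m (n<1+n q-1)) ⟨
    suc (q-1 % q) % q                 ≡⟨ cong (λ u → suc (u % q) % q) (*-identityʳ q-1) ⟨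
    suc (q-1 * 1 % q) % q             ∎
    where open ≡-Reasoning
  residue-suc -[1+ suc n ] = begin
    q-1 * suc n % q                   ≡⟨ [m+n]%n≡m%n (q-1 * suc n) q ⟨
    (q-1 * suc n + q) % q             ≡⟨ cong (_% q) (+-comm (q-1 * suc n) q) ⟩
    suc (q-1 + q-1 * suc n) % q       ≡⟨ cong (λ u → suc u % q) (*-suc q-1 (suc n)) ⟨
    suc (q-1 * suc (suc n)) % q       ≡⟨ [1+m%q]%q≡[1+m]%q (q-1 * suc (suc n)) ⟨
    suc (q-1 * suc (suc n) % q) % q   ∎
    where open ≡-Reasoning

  residue-+ : ∀ j x → residue (x ℤ.+ + j) ≡ (residue x + j) % q
  residue-+ zero    x = begin
    residue (x ℤ.+ + 0)       ≡⟨ cong residue (ℤ.+-identityʳ x) ⟩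
    residue x                 ≡⟨ m<n⇒m%n≡m (residue<q x) ⟨
    residue x % q             ≡⟨ cong (_% q) (+-identityʳ (residue x)) ⟨
    (residue x + 0) % q       ∎
    where open ≡-Reasoning
  residue-+ (suc j) x = begin
    residue (x ℤ.+ + suc j)           ≡⟨ cong (λ u → residue (x ℤ.+ u)) (ℤ.pos-+ 1 j) ⟩
    residue (x ℤ.+ (+ 1 ℤ.+ + j))     ≡⟨ cong residue (ℤ.+-assoc x (+ 1) (+ j)) ⟨
    residue ((x ℤ.+ + 1) ℤ.+ + j)     ≡⟨ residue-+ j (x ℤ.+ + 1) ⟩
    (residue (x ℤ.+ + 1) + j) % q     ≡⟨ cong (λ u → (u + j) % q) (residue-suc x) ⟩
    (suc (residue x) % q + j) % q     ≡⟨ [m%q+n]%q≡[m+n]%q (suc (residue x)) j ⟩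
    (suc (residue x) + j) % q         ≡⟨ cong (_% q) (+-suc (residue x) j) ⟨
    (residue x + suc j) % q           ∎
    where open ≡-Reasoning

module PeriodicExtension {A : Set} (d : A) (k q-1 : ℕ) (w : List A)
                         (|w|≡q+k : length w ≡ suc q-1 + k) (border : left k w ≡ right k w) where
  open Residue q-1

  at-period : ∀ {j} → j < k → at d w (q + j) ≡ at d w j
  at-period {j} j<k = sym (begin
    at d w j                          ≡⟨ at-take d k w j<k ⟨
    at d (take k w) j                 ≡⟨ cong (λ u → at d u j) border ⟩
    at d (right k w) j                ≡⟨ cong (λ u → at d u j) (right≡drop k w k≤|w|) ⟩
    at d (drop (length w ∸ k) w) j    ≡⟨ at-drop d (length w ∸ k) w j ⟩
    at d w (length w ∸ k + j)         ≡⟨ cong (λ u → at d w (u + j)) |w|∸k≡q ⟩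
    at d w (q + j)                    ∎)
    where
    open ≡-Reasoning
    k≤|w| : k ≤ length w
    k≤|w| = subst (k ≤_) (sym |w|≡q+k) (m≤n+m k q)
    |w|∸k≡q : length w ∸ k ≡ q
    |w|∸k≡q = trans (cong (_∸ k) |w|≡q+k) (m+n∸n≡m q k)

  at-+-multiple : ∀ r n → r + n * q < q + k → at d w (r + n * q) ≡ at d w r
  at-+-multiple r zero    _ = cong (at d w) (+-identityʳ r)
  at-+-multiple r (suc n) bound = begin
    at d w (r + (q + n * q))  ≡⟨ cong (at d w) (x∙yz≈y∙xz r q (n * q)) ⟩
    at d w (q + (r + n * q))  ≡⟨ at-period j<k ⟩
    at d w (r + n * q)        ≡⟨ at-+-multiple r n (<-≤-trans j<k (m≤n+m k q)) ⟩
    at d w r                  ∎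
    where
    open ≡-Reasoning
    j<k : r + n * q < k
    j<k = +-cancelˡ-< q (r + n * q) k (subst (_< q + k) (x∙yz≈y∙xz r q (n * q)) bound)

  at-% : ∀ t → t < q + k → at d w (t % q) ≡ at d w t
  at-% t t<q+k = sym (begin
    at d w t                          ≡⟨ cong (at d w) t≡ ⟩
    at d w (t % q + (t / q) * q)      ≡⟨ at-+-multiple (t % q) (t / q) (subst (_< q + k) t≡ t<q+k) ⟩
    at d w (t % q)                    ∎)
    where
    open ≡-Reasoning
    t≡ : t ≡ t % q + (t / q) * q
    t≡ = m≡m%n+[m/n]*n t q

  extension : ℤ → A
  extension x = at d w (residue x)

  extension-+ : ∀ x j → j ≤ k → extension (x ℤ.+ + j) ≡ at d w (residue x + j)
  extension-+ x j j≤k = trans (cong (at d w) (residue-+ j x))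
                              (at-% (residue x + j) (+-mono-<-≤ (residue<q x) j≤k))

  extension-+-within : ∀ {t} → t < length w → extension (+ t) ≡ at d w t
  extension-+-within {t} t<|w| = at-% t (subst (t <_) |w|≡q+k t<|w|)

  extension-window : ∀ (f : Vec A (suc k) → A) x
                   → f (tabulate (λ j → extension (x ℤ.+ + toℕ j)))
                     ≡ at d (successor (suc k) f w) (residue x)
  extension-window f x = trans (cong f (tabulate-cong (λ j → extension-+ x (toℕ j) (toℕ≤pred[n] j))))
                               (sym (at-successor d k f w (residue x) window⊆w))
    where
    window⊆w : residue x + suc k ≤ length w
    window⊆w = subst₂ _≤_ (sym (+-suc (residue x) k)) (sym |w|≡q+k) (+-monoˡ-≤ k (residue<q x))

WindowsAgree : ∀ {A : Set} {m} → (Vec A m → A) → (ℤ → A) → (ℤ → A) → Set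
WindowsAgree f c e =
  ∀ x → f (tabulate (λ j → c (x ℤ.+ + toℕ j))) ≡ f (tabulate (λ j → e (x ℤ.+ + toℕ j)))

periodicLocalConfigs⇒windowsAgree : ∀ {A : Set} {m} k → m ≡ suc k → (f : Vec A m → A) {α β : List A}
  → PeriodicLocalConfigs m f α β → ∃₂ λ c e → WindowsAgree f c e × ¬ (c ≗ e)
periodicLocalConfigs⇒windowsAgree k refl f {α@(a ∷ _)} {β} (m≤|α| , m≤|β| , α≢β , borderα , borderβ , fα≡fβ) =
  Eα.extension , Eβ.extension , agree , differ
  where
  q-1 : ℕ
  q-1 = length α ∸ suc k
  |α|≡ : length α ≡ suc q-1 + k
  |α|≡ = trans (sym (m∸n+n≡m m≤|α|)) (+-suc q-1 k)
  |α|≡|β| : length α ≡ length β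
  |α|≡|β| = ∸-cancelʳ-≡ (<⇒≤ m≤|α|) (<⇒≤ m≤|β|)
    (trans (sym (length-successor a k f α)) (trans (cong length fα≡fβ) (length-successor a k f β)))
  module Eα = PeriodicExtension a k q-1 α |α|≡ borderα
  module Eβ = PeriodicExtension a k q-1 β (trans (sym |α|≡|β|) |α|≡) borderβ
  agree : WindowsAgree f Eα.extension Eβ.extension
  agree x = trans (Eα.extension-window f x)
    (trans (cong (λ u → at a u (Residue.residue q-1 x)) fα≡fβ) (sym (Eβ.extension-window f x)))
  differ : ¬ (Eα.extension ≗ Eβ.extension)
  differ same = α≢β (at-ext a α β |α|≡|β| (λ {t} t< →
    trans (sym (Eα.extension-+-within t<))
          (trans (same (+ t)) (Eβ.extension-+-within (subst (t <_) |α|≡|β| t<)))))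

lemma3 : (p L R : ℕ) (f : Vec (Fin p) (L + 1 + R) → Fin p)
    → (α β : List (Fin p))
    → PeriodicLocalConfigs (L + 1 + R) f α β
    → ¬ InjectiveCA (globalMap L R f)
lemma3 p L R f α β plc injective =
  let c , e , agree , c≉e = periodicLocalConfigs⇒windowsAgree (L + R) (cong (_+ R) (+-comm L 1)) f plc
  in  c≉e (injective c e (λ i → agree (i ℤ.- + L)))
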